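{- There exist Semi-BCI algebras $\langle A,\twoheadrightarrow,\rightarrow,\top\rangle$ such that the reduct $\langle A,\twoheadrightarrow,\top\rangle$ is not a BCI-algebra.
   Context: A BCI-algebra is a structure $\langle A,\rightarrow,\top\rangle$ such that for all $x,y,z\in A$: (C1) $(y\rightarrow z)\rightarrow((z\rightarrow x)\rightarrow(y\rightarrow x))=\top$; (C2) $x\rightarrow((x\rightarrow y)\rightarrow y)=\top$; (C3) $x\rightarrow x=\top$; (C4) $x\rightarrow y=\top$ and $y\rightarrow x=\top$ imply $x=y$. A Semi-BCI (SBCI) algebra is a structure $\langle A,\twoheadrightarrow,\rightarrow,\top\rangle$ with two binary operations and $\top\in A$, where $x\ll y$ iff $x\twoheadrightarrow y=\top$ and $x\preceq y$ iff $x\rightarrow y=\top$, such that for all $x,y,z$: (S1) $x\twoheadrightarrow(y\twoheadrightarrow z)=y\twoheadrightarrow(x\twoheadrightarrow z)$; (S2) $x\rightarrow(y\rightarrow z)=y\rightarrow(x\rightarrow z)$; (S3) $x\twoheadrightarrow y\preceq(z\twoheadrightarrow x)\rightarrow(z\twoheadrightarrow y)$; (S4) $\top\twoheadrightarrow x=x$; (S5) if $x\ll y\preceq z$ then $x\ll z$; (S6) if $x\preceq y\ll z$ then $x\ll z$; (S7) if $x\preceq y$ and $y\preceq x$ then $x=y$. -}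

module Defs where

open import Level using (Level; suc; _⊔_)
open import Relation.Binary.PropositionalEquality using (_≡_)

record IsBCI {a : Level} (A : Set a) (_⇒_ : A → A → A) (⊤ : A) : Set a where
  field
    C1 : ∀ x y z → ((y ⇒ z) ⇒ ((z ⇒ x) ⇒ (y ⇒ x))) ≡ ⊤
    C2 : ∀ x y → (x ⇒ ((x ⇒ y) ⇒ y)) ≡ ⊤
    C3 : ∀ x → (x ⇒ x) ≡ ⊤
    C4 : ∀ x y → (x ⇒ y) ≡ ⊤ → (y ⇒ x) ≡ ⊤ → x ≡ y

record IsSBCI {a : Level} (A : Set a) (_↠_ : A → A → A) (_⇒_ : A → A → A) (⊤ : A) : Set a where
  _≪_ : A → A → Set a
  x ≪ y = (x ↠ y) ≡ ⊤
  _≼_ : A → A → Set a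
  x ≼ y = (x ⇒ y) ≡ ⊤
  field
    S1 : ∀ x y z → (x ↠ (y ↠ z)) ≡ (y ↠ (x ↠ z))
    S2 : ∀ x y z → (x ⇒ (y ⇒ z)) ≡ (y ⇒ (x ⇒ z))
    S3 : ∀ x y z → (x ↠ y) ≼ ((z ↠ x) ⇒ (z ↠ y))
    S4 : ∀ x → (⊤ ↠ x) ≡ x
    S5 : ∀ x y z → x ≪ y → y ≼ z → x ≪ z
    S6 : ∀ x y z → x ≼ y → y ≪ z → x ≪ z
    S7 : ∀ x y → x ≼ y → y ≼ x → x ≡ y

record SBCIAlgebra (a : Level) : Set (suc a) where
  field
    Carrier : Set a
    _↠_ : Carrier → Carrier → Carrier
    _⇒_ : Carrier → Carrier → Carrier
    ⊤ : Carrier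
    isSBCI : IsSBCI Carrier _↠_ _⇒_ ⊤

module Submission where

-- Idea: the first operation of a Semi-BCI algebra may be degenerate.  Take
-- any implication _⇒_ with greatest element ⊤ that is exchangeable (S2),
-- reflexive, antisymmetric (S7) and has ⊤ as a left unit, and pair it with
-- the second projection  x ↠ y = y.  Then S1 and S4 hold trivially, S3
-- reduces to the weakening law y ⇒ (x ⇒ y) = ⊤ (which follows from exchange,
-- reflexivity and ⊤ being greatest), and S5/S6 hold because x ≪ y forces y = ⊤
-- and ⊤ ≼ z forces z = ⊤.  On the other hand, the reduct ⟨A, ↠, ⊤⟩ violates
-- C3 (x ↠ x = x) as soon as A has an element different from ⊤.

open import Defs
open import Level using (Level; 0ℓ)
open import Data.Bool using (Bool; true; false)
open import Data.Product using (Σ; _,_)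
open import Relation.Nullary using (¬_)
open import Relation.Binary.PropositionalEquality using (_≡_; refl; sym; trans; cong; module ≡-Reasoning)

second : ∀ {a} {A : Set a} → A → A → A
second x y = y

module ProjectionSBCI {a : Level} {A : Set a} (_⇒_ : A → A → A) (⊤ : A)
  (exchange : ∀ x y z → (x ⇒ (y ⇒ z)) ≡ (y ⇒ (x ⇒ z)))
  (reflexive : ∀ x → (x ⇒ x) ≡ ⊤)
  (top-greatest : ∀ x → (x ⇒ ⊤) ≡ ⊤)
  (left-unit : ∀ z → (⊤ ⇒ z) ≡ z)
  (antisymmetric : ∀ x y → (x ⇒ y) ≡ ⊤ → (y ⇒ x) ≡ ⊤ → x ≡ y)
  where

  weakening : ∀ x y → (y ⇒ (x ⇒ y)) ≡ ⊤
  weakening x y = begin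
    y ⇒ (x ⇒ y)  ≡⟨ exchange y x y ⟩
    x ⇒ (y ⇒ y)  ≡⟨ cong (x ⇒_) (reflexive y) ⟩
    x ⇒ ⊤        ≡⟨ top-greatest x ⟩
    ⊤            ∎
    where open ≡-Reasoning

  top-below-only-top : ∀ y z → y ≡ ⊤ → (y ⇒ z) ≡ ⊤ → z ≡ ⊤
  top-below-only-top y z refl ⊤≼z = trans (sym (left-unit z)) ⊤≼z

  isSBCI : IsSBCI A second _⇒_ ⊤
  isSBCI = record
    { S1 = λ x y z → refl
    ; S2 = exchange
    ; S3 = λ x y z → weakening x y
    ; S4 = λ x → refl
    ; S5 = λ x y z → top-below-only-top y z
    ; S6 = λ x y z _ z≡⊤ → z≡⊤
    ; S7 = antisymmetric
    }

projection-not-BCI : ∀ {a} {A : Set a} (⊤ x : A) → ¬ x ≡ ⊤ → ¬ IsBCI A second ⊤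
projection-not-BCI ⊤ x x≢⊤ bci = x≢⊤ (IsBCI.C3 bci x)

_⇒ᵇ_ : Bool → Bool → Bool
true  ⇒ᵇ y = y
false ⇒ᵇ y = true

⇒ᵇ-exchange : ∀ x y z → (x ⇒ᵇ (y ⇒ᵇ z)) ≡ (y ⇒ᵇ (x ⇒ᵇ z))
⇒ᵇ-exchange true  true  z = refl
⇒ᵇ-exchange true  false z = refl
⇒ᵇ-exchange false true  z = refl
⇒ᵇ-exchange false false z = refl

⇒ᵇ-reflexive : ∀ x → (x ⇒ᵇ x) ≡ true
⇒ᵇ-reflexive true  = refl
⇒ᵇ-reflexive false = refl

⇒ᵇ-top-greatest : ∀ x → (x ⇒ᵇ true) ≡ true
⇒ᵇ-top-greatest true  = refl
⇒ᵇ-top-greatest false = refl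

⇒ᵇ-antisymmetric : ∀ x y → (x ⇒ᵇ y) ≡ true → (y ⇒ᵇ x) ≡ true → x ≡ y
⇒ᵇ-antisymmetric true  true  _  _  = refl
⇒ᵇ-antisymmetric false false _  _  = refl
⇒ᵇ-antisymmetric true  false () _
⇒ᵇ-antisymmetric false true  _  ()

false≢true : ¬ false ≡ true
false≢true ()

boolProjectionSBCI : SBCIAlgebra 0ℓ
boolProjectionSBCI = record
  { Carrier = Bool
  ; _↠_     = second
  ; _⇒_     = _⇒ᵇ_
  ; ⊤       = true
  ; isSBCI  = ProjectionSBCI.isSBCI _⇒ᵇ_ true
                ⇒ᵇ-exchange ⇒ᵇ-reflexive ⇒ᵇ-top-greatest (λ z → refl) ⇒ᵇ-antisymmetric
  }

proposition12 : Σ (SBCIAlgebra 0ℓ) (λ S → ¬ IsBCI (SBCIAlgebra.Carrier S) (SBCIAlgebra._↠_ S) (SBCIAlgebra.⊤ S))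
proposition12 = boolProjectionSBCI , projection-not-BCI true false false≢true
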